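{- Let $\Sigma$ be a set. Then $(\mathrm{preord}, \mathrm{Abs}(\wp(\Sigma))_{\sqsupseteq}, \mathrm{PreOrd}(\Sigma)_{\supseteq}, \mathrm{dis})$ is a Galois connection; that is, for every $A\in\mathrm{Abs}(\wp(\Sigma))$ and every $R\in\mathrm{PreOrd}(\Sigma)$, $R\subseteq\mathrm{preord}(A)\iff\mathrm{dis}(R)\sqsubseteq A$.
   Context: $\mathrm{PreOrd}(\Sigma)$ is the set of preorders (reflexive, transitive relations) on $\Sigma$. Abstract domains $A\in\mathrm{Abs}(\wp(\Sigma))$ are given by Galois insertions $(\alpha,\wp(\Sigma),A,\gamma)$ ($\alpha(S)\le a\iff S\subseteq\gamma(a)$, $\alpha\circ\gamma=\mathrm{id}$), identified by their closures $\mu_A=\gamma\circ\alpha$ and ordered by $A_1\sqsubseteq A_2$ iff $\mu_{A_1}(S)\subseteq\mu_{A_2}(S)$ for all $S$. For $R\in\mathrm{PreOrd}(\Sigma)$, $\mathrm{dis}(R)$ is the abstract domain $\wp(\{\mathrm{pre}_R(\{x\})\mid x\in\Sigma\})_\subseteq$ with $\alpha_R(S)=\{\mathrm{pre}_R(\{x\})\mid x\in S\}$ and $\gamma_R(\mathcal{X})=\bigcup\mathcal{X}$, where $\mathrm{pre}_R(Y)=\{x\mid\exists y\in Y.\,xRy\}$; its closure is $\mathrm{pre}_R$. For $A\in\mathrm{Abs}(\wp(\Sigma))$, $\mathrm{preord}(A)=\{(x,y)\mid\alpha(\{x\})\le_A\alpha(\{y\})\}$. -}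

module Defs where

open import Level using (0ℓ)
open import Data.Product using (Σ; ∃; _×_; _,_; proj₁; proj₂)
open import Relation.Unary using (Pred; _⊆_; ｛_｝)
open import Relation.Binary.Core using (Rel)
open import Relation.Binary.Structures using (IsPartialOrder; IsPreorder)
open import Relation.Binary.PropositionalEquality using (_≡_; refl)

℘ : Set → Set₁
℘ Σ' = Pred Σ' 0ℓ

record AbsDomain (Σ' : Set) : Set₂ where
  field
    Carrier   : Set₁
    _≈_       : Rel Carrier 0ℓ
    _≤_       : Rel Carrier 0ℓ
    isPartialOrder : IsPartialOrder _≈_ _≤_
    α         : ℘ Σ' → Carrier
    γ         : Carrier → ℘ Σ'
    gc-⇒      : ∀ (S : ℘ Σ') (a : Carrier) → α S ≤ a → S ⊆ γ a
    gc-⇐      : ∀ (S : ℘ Σ') (a : Carrier) → S ⊆ γ a → α S ≤ a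
    insertion : ∀ (a : Carrier) → α (γ a) ≈ a

  μ : ℘ Σ' → ℘ Σ'
  μ S = γ (α S)

open AbsDomain public

_⊑_ : {Σ' : Set} → AbsDomain Σ' → AbsDomain Σ' → Set₁
A₁ ⊑ A₂ = ∀ S → μ A₁ S ⊆ μ A₂ S

record PreOrd (Σ' : Set) : Set₁ where
  field
    rel        : Rel Σ' 0ℓ
    isPreorder : IsPreorder _≡_ rel

open PreOrd public

_⊆ᵣ_ : {Σ' : Set} → Rel Σ' 0ℓ → Rel Σ' 0ℓ → Set
R ⊆ᵣ R' = ∀ {x y} → R x y → R' x y

pre : {Σ' : Set} → Rel Σ' 0ℓ → ℘ Σ' → ℘ Σ'
pre R Y x = ∃ λ y → Y y × R x y

preord : {Σ' : Set} → AbsDomain Σ' → Rel Σ' 0ℓ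
preord A x y = _≤_ A (α A ｛ x ｝) (α A ｛ y ｝)

-- dis(R) = ℘({pre_R({x}) | x ∈ Σ}) with α_R(S) = {pre_R{x} | x ∈ S},
-- γ_R(𝒳) = ⋃ 𝒳.  A family 𝒳 of principal down-sets is represented by the
-- (R-down-closed) set of its generators.
DownSet : {Σ' : Set} → Rel Σ' 0ℓ → Set₁
DownSet {Σ'} R = Σ (℘ Σ') λ X → ∀ {x y} → R x y → X y → X x

module _ {Σ' : Set} (P : PreOrd Σ') where
  private
    R = rel P
    module P = IsPreorder (isPreorder P)

  dis-≤ : Rel (DownSet R) 0ℓ
  dis-≤ X Y = proj₁ X ⊆ proj₁ Y

  dis-≈ : Rel (DownSet R) 0ℓ
  dis-≈ X Y = dis-≤ X Y × dis-≤ Y X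

  dis-isPartialOrder : IsPartialOrder dis-≈ dis-≤
  dis-isPartialOrder = record
    { isPreorder = record
      { isEquivalence = record
        { refl = (λ z → z) , (λ z → z)
        ; sym = λ { (p , q) → q , p }
        ; trans = λ { (p , q) (p' , q') → (λ z → p' (p z)) , (λ z → q (q' z)) } }
      ; reflexive = proj₁
      ; trans = λ p q z → q (p z) }
    ; antisym = _,_ }

  dis-α : ℘ Σ' → DownSet R
  dis-α S = pre R S , λ { xRy (z , Sz , yRz) → z , Sz , P.trans xRy yRz }

  dis-γ : DownSet R → ℘ Σ'
  dis-γ X = proj₁ X

  dis : AbsDomain Σ'
  dis = record
    { Carrier = DownSet R
    ; _≈_ = dis-≈
    ; _≤_ = dis-≤
    ; isPartialOrder = dis-isPartialOrder
    ; α = dis-α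
    ; γ = dis-γ
    ; gc-⇒ = λ S a le Sx → le (_ , Sx , P.refl)
    ; gc-⇐ = λ S a sub → λ { (z , Sz , xRz) → proj₂ a xRz (sub Sz) }
    ; insertion = λ a → (λ { (z , az , xRz) → proj₂ a xRz az }) , (λ az → _ , az , P.refl)
    }

{-# OPTIONS --safe #-}
module Submission where

open import Level using (0ℓ)
open import Data.Product using (_,_)
open import Function.Base using (id)
open import Function.Bundles using (_⇔_; mk⇔)
open import Relation.Binary.Core using (Rel)
open import Relation.Binary.PropositionalEquality using (refl)
open import Relation.Binary.Structures using (IsPartialOrder)
open import Relation.Unary using (_∈_; _⊆_; ｛_｝)

open import Defs

-- The key fact is that
-- preord A is membership in the closure of a singleton, x ≤ y ⇔ x ∈ μ {y}; hence
-- R ⊆ preord A says pre_R {y} ⊆ μ {y} for every y, which extends to every S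
-- because pre_R S is the union of the pre_R {y} with y ∈ S and μ is monotone.

module _ {Σ' : Set} (A : AbsDomain Σ') where
  private
    module A = AbsDomain A
    module ≤ = IsPartialOrder A.isPartialOrder

  μ-extensive : ∀ S → S ⊆ A.μ S
  μ-extensive S = A.gc-⇒ S (A.α S) ≤.refl

  α-mono : ∀ {S T} → S ⊆ T → A._≤_ (A.α S) (A.α T)
  α-mono {S} {T} S⊆T = A.gc-⇐ S (A.α T) (λ Sx → μ-extensive T (S⊆T Sx))

  γ-mono : ∀ {a b} → A._≤_ a b → A.γ a ⊆ A.γ b
  γ-mono {a} {b} a≤b = A.gc-⇒ (A.γ a) b (≤.trans (A.gc-⇐ (A.γ a) a id) a≤b)

  μ-mono : ∀ {S T} → S ⊆ T → A.μ S ⊆ A.μ T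
  μ-mono S⊆T = γ-mono (α-mono S⊆T)

  preord⇒∈μ｛｝ : ∀ {x y} → preord A x y → x ∈ A.μ ｛ y ｝
  preord⇒∈μ｛｝ x≤y = A.gc-⇒ _ _ x≤y refl

  ∈μ｛｝⇒preord : ∀ {x y} → x ∈ A.μ ｛ y ｝ → preord A x y
  ∈μ｛｝⇒preord x∈μy = A.gc-⇐ _ _ λ { refl → x∈μy }

  ⊆preord⇔pre⊆μ : (R : Rel Σ' 0ℓ) → (R ⊆ᵣ preord A) ⇔ (∀ S → pre R S ⊆ A.μ S)
  ⊆preord⇔pre⊆μ R = mk⇔ to from
    where
    to : R ⊆ᵣ preord A → ∀ S → pre R S ⊆ A.μ S
    to R⊆≤ S (y , Sy , xRy) = μ-mono (λ { refl → Sy }) (preord⇒∈μ｛｝ (R⊆≤ xRy))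

    from : (∀ S → pre R S ⊆ A.μ S) → R ⊆ᵣ preord A
    from pre⊆μ {y = y} xRy = ∈μ｛｝⇒preord (pre⊆μ ｛ y ｝ (y , refl , xRy))

theorem7p7 : (Σ' : Set) (A : AbsDomain Σ') (R : PreOrd Σ') →
             (rel R ⊆ᵣ preord A) ⇔ (dis R ⊑ A)
-- μ (dis R) S computes to pre (rel R) S, so dis R ⊑ A is definitionally ∀ S → pre (rel R) S ⊆ μ A S.
theorem7p7 Σ' A R = ⊆preord⇔pre⊆μ A (rel R)
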